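{- Let $(G,k,F,w)$ be an instance of \textsc{Generalized 2-Club Cluster Vertex Deletion} with $G=(V,E)$, and let $v\in V\setminus F$. Let $C_1,\dots,C_\ell$ be (the vertex sets of) all connected components of $G-v$ that induce 2-clubs, and let $H=G-v-C_1-\dots-C_\ell$. Suppose that $\mathrm{robust}_G(a,b)>k$ for all pairs of distinct vertices $a,b\in N_G(v)\cap V(H)$, and that $w(v)\le\min_{u\in C_i}w(u)$ for every $i\in\{1,\dots,\ell\}$. Then $(G,k,F,w)$ is a yes-instance if and only if $(G,k,F\cup C_1\cup\dots\cup C_\ell,w)$ is a yes-instance.
   Context: All graphs are finite, simple and undirected. A 2-club is a graph of diameter at most two; a 2-club cluster graph is a graph each of whose connected components is a 2-club. An induced $P_4$ $stuv$ is a path on distinct vertices $s,t,u,v$ with edges $\{s,t\},\{t,u\},\{u,v\}$ and no other edges among these four vertices. For a weight function $w$ and a vertex set $S$, $w(S)=\sum_{x\in S}w(x)$. For vertices $s,v$, the robustness is $\mathrm{robust}_G(s,v)=\infty$ if there are no $t,u$ such that $stuv$ is an induced $P_4$ in $G$, and $\mathrm{robust}_G(s,v)=w(N(s)\cap N(v))$ otherwise. \textsc{Generalized 2-Club Cluster Vertex Deletion}: an instance $(G,k,F,w)$ consists of an undirected graph $G=(V,E)$, an integer $k$, a set $F\subseteq V$ of permanent vertices and a weight function $w:V\to\mathbb{N}^+$; it is a yes-instance iff there is $S\subseteq V$ with $w(S)\le k$ and $S\cap F=\emptyset$ such that $G[V\setminus S]$ is a 2-club cluster graph. -}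

module Defs where

open import Data.Nat using (ℕ; zero; suc; _+_; _≤_; _<_)
open import Data.Fin using (Fin; zero; suc)
open import Data.Bool using (Bool; true; false; if_then_else_; _∧_)
open import Data.Vec using (Vec; []; _∷_; tabulate)
open import Data.Fin.Subset using (Subset; _∈_; _∉_)
open import Data.Product using (Σ; ∃; ∃-syntax; _×_; _,_)
open import Data.Sum using (_⊎_)
open import Relation.Binary.PropositionalEquality using (_≡_; _≢_)
open import Relation.Nullary using (¬_)

record Graph : Set where
  field
    n      : ℕ
    adj    : Fin n → Fin n → Bool
    sym    : ∀ x y → adj x y ≡ adj y x
    irrefl : ∀ x → adj x x ≡ false

open Graph public

Vtx : Graph → Set
Vtx G = Fin (n G)

Edge : (G : Graph) → Vtx G → Vtx G → Set
Edge G x y = adj G x y ≡ true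

wsum : ∀ {m} → (Fin m → ℕ) → Subset m → ℕ
wsum {zero}  w []      = 0
wsum {suc m} w (b ∷ S) = (if b then w zero else 0) + wsum (λ x → w (suc x)) S

commonNbhd : (G : Graph) → Vtx G → Vtx G → Subset (n G)
commonNbhd G a b = tabulate (λ x → adj G a x ∧ adj G b x)

InducedP4 : (G : Graph) → Vtx G → Vtx G → Vtx G → Vtx G → Set
InducedP4 G s t u v =
  (s ≢ t × s ≢ u × s ≢ v × t ≢ u × t ≢ v × u ≢ v) ×
  (Edge G s t × Edge G t u × Edge G u v) ×
  (¬ Edge G s u × ¬ Edge G t v × ¬ Edge G s v)

-- robust_G(s,v) > k  (robust = ∞ if no induced P4 s t u v, else w(N(s) ∩ N(v)))
RobustGt : (G : Graph) → (Vtx G → ℕ) → Vtx G → Vtx G → ℕ → Set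
RobustGt G w s v k =
  (¬ (∃[ t ] ∃[ u ] InducedP4 G s t u v)) ⊎ (k < wsum w (commonNbhd G s v))

data Reach (G : Graph) (X : Vtx G → Set) : Vtx G → Vtx G → Set where
  here : ∀ {x} → X x → Reach G X x x
  step : ∀ {x z y} → X x → Edge G x z → Reach G X z y → Reach G X x y

Dist≤2 : (G : Graph) → (X : Vtx G → Set) → Vtx G → Vtx G → Set
Dist≤2 G X x y = x ≡ y ⊎ Edge G x y ⊎ (∃[ m ] (X m × Edge G x m × Edge G m y))

Is2ClubCluster : (G : Graph) → (Vtx G → Set) → Set
Is2ClubCluster G X = ∀ x y → Reach G X x y → Dist≤2 G X x y

YesInstance : (G : Graph) → ℕ → (Vtx G → Set) → (Vtx G → ℕ) → Set
YesInstance G k F w =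
  Σ (Subset (n G)) λ S →
    (wsum w S ≤ k) × (∀ x → x ∈ S → ¬ F x) × Is2ClubCluster G (λ x → x ∉ S)

Minus : (G : Graph) → Vtx G → Vtx G → Set
Minus G v x = x ≢ v

-- x lies in C_1 ∪ … ∪ C_ℓ : x ∈ V(G - v) and the connected component of x in
-- G - v induces a 2-club
InClubComp : (G : Graph) → Vtx G → Vtx G → Set
InClubComp G v x =
  x ≢ v × (∀ y z → Reach G (Minus G v) x y → Reach G (Minus G v) x z →
                   Dist≤2 G (Minus G v) y z)

InH : (G : Graph) → Vtx G → Vtx G → Set
InH G v x = x ≢ v × ¬ InClubComp G v x

-- Suppose a solution S deletes a vertex u of some 2-club component C_i of G - v.
-- Replace S by S' = {v} ∪ (S ∖ C), where C = C_1 ∪ … ∪ C_ℓ. Since w(v) ≤ w(u), S' is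
-- no heavier than S, and it avoids C. In G - S' every C_i is still a component and a
-- 2-club. A component of G - S' inside H that is not a 2-club contains an induced P4
-- x z m y; its ends are at distance two in G - S, but every common neighbour outside S
-- is v. Then x, y ∈ N(v) ∩ V(H), so robust(x, y) > k, whereas
-- N(x) ∩ N(y) ⊆ S' has weight at most w(S) ≤ k.
module Submission where

open import Defs
open import Algebra.Properties.CommutativeSemigroup using (interchange)
open import Data.Bool.Base using (Bool; true; false; _∧_; _∨_; not; if_then_else_)
import Data.Bool.Properties as Bool
open import Data.Fin.Base using (Fin; zero; suc)
open import Data.Fin.Properties using (_≟_; any?; all?)
open import Data.Fin.Subset
  using (Subset; inside; outside; _∈_; _∉_; _⊆_; ⊥; ⁅_⁆; _∪_; _∩_; ∁)
open import Data.Fin.Subset.Properties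
  using (_∈?_; drop-∷-⊆; ⊆-refl; x∈⁅y⁆⇒x≡y; x∈⁅x⁆; x∈p∪q⁻; x∈p∪q⁺; x∈p∩q⁻; x∈p∩q⁺;
         x∈∁p⇒x∉p; x∉p⇒x∈∁p)
open import Data.Nat.Base using (ℕ; zero; suc; _+_; _≤_; _<_; z≤n)
open import Data.Nat.Properties
  using (≤-refl; ≤-trans; +-mono-≤; +-monoˡ-≤; +-monoʳ-≤; +-identityʳ;
         m≤m+n; m≤n⇒m≤o+n; ≤⇒≯; +-commutativeSemigroup; module ≤-Reasoning)
open import Data.Product.Base using (∃-syntax; _×_; _,_; proj₁; proj₂)
open import Data.Empty using (⊥-elim)
open import Data.Sum.Base using (_⊎_; inj₁; inj₂; [_,_])
open import Data.Vec.Base using ([]; _∷_; tabulate; here)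
open import Data.Vec.Properties using (lookup∘tabulate; []=⇒lookup; lookup⇒[]=)
open import Function.Base using (_∘_)
open import Function.Bundles using (_⇔_; mk⇔)
open import Relation.Binary.PropositionalEquality using (_≡_; _≢_; refl; trans; cong; cong₂)
import Relation.Binary.PropositionalEquality as ≡
open import Relation.Nullary using (¬_; Dec; yes; no; does)
open import Relation.Nullary.Decidable
  using (_×-dec_; _⊎-dec_; _→-dec_; ¬?; map′; decidable-stable; dec-true; dec-false)
open import Relation.Unary using (Decidable)

wsum-⊥ : ∀ {m} (w : Fin m → ℕ) → wsum w ⊥ ≡ 0
wsum-⊥ {zero}  w = refl
wsum-⊥ {suc m} w = wsum-⊥ (w ∘ suc)

wsum-⁅⁆ : ∀ {m} (w : Fin m → ℕ) (i : Fin m) → wsum w ⁅ i ⁆ ≡ w i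
wsum-⁅⁆ w zero    = trans (cong (w zero +_) (wsum-⊥ (w ∘ suc))) (+-identityʳ (w zero))
wsum-⁅⁆ w (suc i) = wsum-⁅⁆ (w ∘ suc) i

wsum-mono : ∀ {m} (w : Fin m → ℕ) {p q : Subset m} → p ⊆ q → wsum w p ≤ wsum w q
wsum-mono w {[]}          {[]}    _   = z≤n
wsum-mono w {outside ∷ p} {s ∷ q} p⊆q =
  m≤n⇒m≤o+n (if s then w zero else 0) (wsum-mono (w ∘ suc) (drop-∷-⊆ p⊆q))
wsum-mono w {inside ∷ p}  {s ∷ q} p⊆q with p⊆q here
... | here = +-monoʳ-≤ (w zero) (wsum-mono (w ∘ suc) (drop-∷-⊆ p⊆q))

wsum-∪ : ∀ {m} (w : Fin m → ℕ) (p q : Subset m) →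
         wsum w (p ∪ q) ≤ wsum w p + wsum w q
wsum-∪ w []      []      = z≤n
wsum-∪ w (a ∷ p) (b ∷ q) = begin
  sel (a ∨ b) + wsum w′ (p ∪ q)
    ≤⟨ +-mono-≤ (sel-∨ a b) (wsum-∪ w′ p q) ⟩
  (sel a + sel b) + (wsum w′ p + wsum w′ q)
    ≡⟨ interchange +-commutativeSemigroup (sel a) (sel b) _ _ ⟩
  (sel a + wsum w′ p) + (sel b + wsum w′ q) ∎
  where
  open ≤-Reasoning
  w′ = w ∘ suc
  sel : Bool → ℕ
  sel c = if c then w zero else 0
  sel-∨ : ∀ a b → sel (a ∨ b) ≤ sel a + sel b
  sel-∨ true  _     = m≤m+n (w zero) _
  sel-∨ false true  = ≤-refl
  sel-∨ false false = z≤n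

wsum-split : ∀ {m} (w : Fin m → ℕ) (p q : Subset m) →
             wsum w p ≡ wsum w (p ∩ q) + wsum w (p ∩ ∁ q)
wsum-split w []      []      = refl
wsum-split w (a ∷ p) (b ∷ q) = begin
  sel a + wsum w′ p
    ≡⟨ cong₂ _+_ (sel-split a b) (wsum-split w′ p q) ⟩
  (sel (a ∧ b) + sel (a ∧ not b)) + (wsum w′ (p ∩ q) + wsum w′ (p ∩ ∁ q))
    ≡⟨ interchange +-commutativeSemigroup (sel (a ∧ b)) (sel (a ∧ not b)) _ _ ⟩
  (sel (a ∧ b) + wsum w′ (p ∩ q)) + (sel (a ∧ not b) + wsum w′ (p ∩ ∁ q)) ∎
  where
  open ≡.≡-Reasoning
  w′ = w ∘ suc
  sel : Bool → ℕ
  sel c = if c then w zero else 0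
  sel-split : ∀ a b → sel a ≡ sel (a ∧ b) + sel (a ∧ not b)
  sel-split true  true  = ≡.sym (+-identityʳ (w zero))
  sel-split true  false = refl
  sel-split false _     = refl

∈-tabulate⁻ : ∀ {m} {f : Fin m → Bool} {x} → x ∈ tabulate f → f x ≡ true
∈-tabulate⁻ {f = f} {x} x∈ = trans (≡.sym (lookup∘tabulate f x)) ([]=⇒lookup x∈)

∈-tabulate⁺ : ∀ {m} {f : Fin m → Bool} {x} → f x ≡ true → x ∈ tabulate f
∈-tabulate⁺ {f = f} {x} fx = lookup⇒[]= x (tabulate f) (trans (lookup∘tabulate f x) fx)

module Walks (G : Graph) where

  Edge-sym : ∀ {a b} → Edge G a b → Edge G b a
  Edge-sym {a} {b} ab = trans (sym G b a) ab

  Edge-irrefl : ∀ {a b} → Edge G a b → a ≢ b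
  Edge-irrefl {a} aa refl with trans (≡.sym aa) (irrefl G a)
  ... | ()

  Edge? : ∀ a b → Dec (Edge G a b)
  Edge? a b = adj G a b Bool.≟ true

  ∈-commonNbhd⁻ : ∀ {a b c} → c ∈ commonNbhd G a b → Edge G a c × Edge G b c
  ∈-commonNbhd⁻ {a} {b} {c} c∈ = ∧-true (adj G a c) (adj G b c) (∈-tabulate⁻ c∈)
    where
    ∧-true : ∀ s t → s ∧ t ≡ true → s ≡ true × t ≡ true
    ∧-true true true refl = refl , refl

  Reach-start : ∀ {X a b} → Reach G X a b → X a
  Reach-start (here a∈) = a∈
  Reach-start (step a∈ _ _) = a∈

  Reach-end : ∀ {X a b} → Reach G X a b → X b
  Reach-end (here a∈) = a∈
  Reach-end (step _ _ r) = Reach-end r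

  Reach-++ : ∀ {X a b c} → Reach G X a b → Reach G X b c → Reach G X a c
  Reach-++ (here _) s = s
  Reach-++ (step a∈ e r) s = step a∈ e (Reach-++ r s)

  Reach-mono : ∀ {X Y : Vtx G → Set} {a b} → (∀ {x} → X x → Y x) →
               Reach G X a b → Reach G Y a b
  Reach-mono X⊆Y (here a∈) = here (X⊆Y a∈)
  Reach-mono X⊆Y (step a∈ e r) = step (X⊆Y a∈) e (Reach-mono X⊆Y r)

  Dist≤2⇒Reach : ∀ {X a b} → X a → X b → Dist≤2 G X a b → Reach G X a b
  Dist≤2⇒Reach a∈ b∈ (inj₁ refl) = here a∈
  Dist≤2⇒Reach a∈ b∈ (inj₂ (inj₁ ab)) = step a∈ ab (here b∈)
  Dist≤2⇒Reach a∈ b∈ (inj₂ (inj₂ (m , m∈ , am , mb))) = step a∈ am (step m∈ mb (here b∈))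

  Dist≤2-mono : ∀ {X Y : Vtx G → Set} {a b} → (∀ {m} → X m → Edge G a m → Y m) →
                Dist≤2 G X a b → Dist≤2 G Y a b
  Dist≤2-mono _ (inj₁ a≡b) = inj₁ a≡b
  Dist≤2-mono _ (inj₂ (inj₁ ab)) = inj₂ (inj₁ ab)
  Dist≤2-mono X⇒Y (inj₂ (inj₂ (m , m∈ , am , mb))) = inj₂ (inj₂ (m , X⇒Y m∈ am , am , mb))

  Dist≤2? : ∀ {X} → Decidable X → ∀ a b → Dec (Dist≤2 G X a b)
  Dist≤2? X? a b =
    a ≟ b ⊎-dec Edge? a b ⊎-dec any? (λ m → X? m ×-dec Edge? a m ×-dec Edge? m b)

  walk-shortcut-or-P4 : ∀ {X x z m y} → X z → X m → Edge G x z → Edge G z m → Edge G m y →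
                        Dist≤2 G X x y ⊎ InducedP4 G x z m y
  walk-shortcut-or-P4 {x = x} {z} {m} {y} z∈ m∈ xz zm my
    with x ≟ y | Edge? x y | Edge? z y | x ≟ m | Edge? x m
  ... | yes x≡y | _      | _      | _        | _      = inj₁ (inj₁ x≡y)
  ... | no _    | yes xy | _      | _        | _      = inj₁ (inj₂ (inj₁ xy))
  ... | no _    | no _   | yes zy | _        | _      = inj₁ (inj₂ (inj₂ (z , z∈ , xz , zy)))
  ... | no _    | no _   | no _   | yes refl | _      = inj₁ (inj₂ (inj₁ my))
  ... | no _    | no _   | no _   | no _     | yes xm = inj₁ (inj₂ (inj₂ (m , m∈ , xm , my)))
  ... | no x≢y  | no ¬xy | no ¬zy | no x≢m   | no ¬xm =
    inj₂ ( (Edge-irrefl xz , x≢m , x≢y , Edge-irrefl zm , (λ { refl → ¬xy xz }) , Edge-irrefl my)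
         , (xz , zm , my)
         , (¬xm , ¬zy , ¬xy))

module Clubs (G : Graph) (v : Vtx G) where

  open Walks G

  private
    M : Vtx G → Set
    M = Minus G v

  club-Reach : ∀ {a b} → InClubComp G v a → Reach G M a b → InClubComp G v b
  club-Reach (_ , diam) r = Reach-end r , λ y z ry rz → diam y z (Reach-++ r ry) (Reach-++ r rz)

  ¬club-Edge : ∀ {a b} → ¬ InClubComp G v a → a ≢ v → Edge G a b → b ≢ v → ¬ InClubComp G v b
  ¬club-Edge ¬ca a≢v ab b≢v cb = ¬ca (club-Reach cb (step b≢v (Edge-sym ab) (here a≢v)))

  -- A component of G - v is a 2-club iff the ball of radius two around one of its
  -- vertices is closed under edges and has diameter two; unlike InClubComp, this
  -- quantifies over vertices rather than walks, so it is decidable.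
  ClubBall : Vtx G → Set
  ClubBall x = x ≢ v
    × (∀ b c → Dist≤2 G M x b → M b → Edge G b c → M c → Dist≤2 G M x c)
    × (∀ b c → Dist≤2 G M x b → M b → Dist≤2 G M x c → M c → Dist≤2 G M b c)

  ClubBall? : Decidable ClubBall
  ClubBall? x = M? x
    ×-dec all? (λ b → all? (λ c →
            Dist≤2? M? x b →-dec M? b →-dec Edge? b c →-dec M? c →-dec Dist≤2? M? x c))
    ×-dec all? (λ b → all? (λ c →
            Dist≤2? M? x b →-dec M? b →-dec Dist≤2? M? x c →-dec M? c →-dec Dist≤2? M? b c))
    where
    M? : Decidable M
    M? y = ¬? (y ≟ v)

  ClubBall⇒club : ∀ {x} → ClubBall x → InClubComp G v x
  ClubBall⇒club {x} (x≢v , closed , diam) = x≢v , λ y z ry rz →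
    diam y z (ball-Reach ry (inj₁ refl)) (Reach-end ry) (ball-Reach rz (inj₁ refl)) (Reach-end rz)
    where
    ball-Reach : ∀ {a y} → Reach G M a y → Dist≤2 G M x a → Dist≤2 G M x y
    ball-Reach (here _) xa = xa
    ball-Reach (step a∈ ab r) xa = ball-Reach r (closed _ _ xa a∈ ab (Reach-start r))

  club⇒ClubBall : ∀ {x} → InClubComp G v x → ClubBall x
  club⇒ClubBall {x} (x≢v , diam) = x≢v
    , (λ b c xb b≢v bc c≢v →
         diam x c (here x≢v) (Reach-++ (Dist≤2⇒Reach x≢v b≢v xb) (step b≢v bc (here c≢v))))
    , (λ b c xb b≢v xc c≢v → diam b c (Dist≤2⇒Reach x≢v b≢v xb) (Dist≤2⇒Reach x≢v c≢v xc))

  InClubComp? : Decidable (InClubComp G v)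
  InClubComp? x = map′ ClubBall⇒club club⇒ClubBall (ClubBall? x)

module Exchange (G : Graph) (w : Vtx G → ℕ) (v : Vtx G)
                (w-club : ∀ u → InClubComp G v u → w v ≤ w u) where

  open Walks G
  open Clubs G v

  clubs : Subset (n G)
  clubs = tabulate (does ∘ InClubComp?)

  ∈-clubs⁺ : ∀ {x} → InClubComp G v x → x ∈ clubs
  ∈-clubs⁺ {x} cx = ∈-tabulate⁺ (dec-true (InClubComp? x) cx)

  ∉-clubs⁺ : ∀ {x} → ¬ InClubComp G v x → x ∉ clubs
  ∉-clubs⁺ {x} ¬cx x∈ with trans (≡.sym (∈-tabulate⁻ x∈)) (dec-false (InClubComp? x) ¬cx)
  ... | ()

  exchange : Subset (n G) → Subset (n G)
  exchange S = ⁅ v ⁆ ∪ S ∩ ∁ clubs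

  ∈-exchange⁻ : ∀ {S x} → x ∈ exchange S → x ≡ v ⊎ (x ∈ S × ¬ InClubComp G v x)
  ∈-exchange⁻ {S} x∈ with x∈p∪q⁻ ⁅ v ⁆ (S ∩ ∁ clubs) x∈
  ... | inj₁ x∈⁅v⁆  = inj₁ (x∈⁅y⁆⇒x≡y v x∈⁅v⁆)
  ... | inj₂ x∈S∖C with x∈p∩q⁻ S (∁ clubs) x∈S∖C
  ...   | x∈S , x∈∁C = inj₂ (x∈S , x∈∁p⇒x∉p x∈∁C ∘ ∈-clubs⁺)

  ∈-exchange⁺ : ∀ {S x} → x ≡ v ⊎ (x ∈ S × ¬ InClubComp G v x) → x ∈ exchange S
  ∈-exchange⁺ (inj₁ refl) = x∈p∪q⁺ (inj₁ (x∈⁅x⁆ v))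
  ∈-exchange⁺ (inj₂ (x∈S , ¬cx)) = x∈p∪q⁺ (inj₂ (x∈p∩q⁺ (x∈S , x∉p⇒x∈∁p (∉-clubs⁺ ¬cx))))

  ∉-exchange⁻ : ∀ {S x} → x ∉ exchange S → x ≢ v × (x ∉ S ⊎ InClubComp G v x)
  ∉-exchange⁻ {S} {x} x∉ = x∉ ∘ ∈-exchange⁺ ∘ inj₁ , kept (InClubComp? x)
    where
    kept : Dec (InClubComp G v x) → x ∉ S ⊎ InClubComp G v x
    kept (yes cx)  = inj₂ cx
    kept (no ¬cx) = inj₁ (λ x∈S → x∉ (∈-exchange⁺ (inj₂ (x∈S , ¬cx))))

  ∉-exchange⁺ : ∀ {S x} → x ≢ v → x ∉ S ⊎ InClubComp G v x → x ∉ exchange S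
  ∉-exchange⁺ x≢v kept x∈ with ∈-exchange⁻ x∈
  ... | inj₁ x≡v         = x≢v x≡v
  ... | inj₂ (x∈S , ¬cx) = [ (λ x∉S → x∉S x∈S) , ¬cx ] kept

  exchange-avoids : ∀ {F : Vtx G → Set} {S} → ¬ F v → (∀ x → x ∈ S → ¬ F x) →
                    ∀ x → x ∈ exchange S → ¬ (F x ⊎ InClubComp G v x)
  exchange-avoids ¬Fv S∩F x x∈ with ∈-exchange⁻ x∈
  ... | inj₁ refl        = [ ¬Fv , (λ cv → proj₁ cv refl) ]
  ... | inj₂ (x∈S , ¬cx) = [ S∩F x x∈S , ¬cx ]

  exchange-bounded : ∀ {S T u} → u ∈ S → InClubComp G v u → T ⊆ exchange S →
                     wsum w T ≤ wsum w S
  exchange-bounded {S} {T} {u} u∈S cu T⊆ = begin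
    wsum w T                           ≤⟨ wsum-mono w T⊆ ⟩
    wsum w (exchange S)                ≤⟨ wsum-∪ w ⁅ v ⁆ (S ∩ ∁ clubs) ⟩
    wsum w ⁅ v ⁆ + rest                ≡⟨ cong (_+ rest) (wsum-⁅⁆ w v) ⟩
    w v + rest                         ≤⟨ +-monoˡ-≤ rest (w-club u cu) ⟩
    w u + rest                         ≡⟨ cong (_+ rest) (wsum-⁅⁆ w u) ⟨
    wsum w ⁅ u ⁆ + rest                ≤⟨ +-monoˡ-≤ rest (wsum-mono w ⁅u⁆⊆S∩C) ⟩
    wsum w (S ∩ clubs) + rest          ≡⟨ wsum-split w S clubs ⟨
    wsum w S                           ∎
    where
    open ≤-Reasoning
    rest : ℕ
    rest = wsum w (S ∩ ∁ clubs)
    ⁅u⁆⊆S∩C : ⁅ u ⁆ ⊆ S ∩ clubs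
    ⁅u⁆⊆S∩C x∈ with x∈⁅y⁆⇒x≡y u x∈
    ... | refl = x∈p∩q⁺ (u∈S , ∈-clubs⁺ cu)

  module _ {k : ℕ} {S : Subset (n G)} {u : Vtx G}
           (robust : ∀ a b → a ≢ b → Edge G v a → InH G v a → Edge G v b → InH G v b →
                     RobustGt G w a b k)
           (S-cluster : Is2ClubCluster G (_∉ S)) (wS≤k : wsum w S ≤ k)
           (u∈S : u ∈ S) (cu : InClubComp G v u) where

    Kept : Vtx G → Set
    Kept = _∉ exchange S

    CommonOutside : Vtx G → Vtx G → Set
    CommonOutside x y = ∃[ c ] (c ∉ S × c ≢ v × Edge G x c × Edge G c y)

    kept⇒≢v : ∀ {x} → Kept x → x ≢ v
    kept⇒≢v = proj₁ ∘ ∉-exchange⁻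

    kept-¬club⇒∉S : ∀ {x} → Kept x → ¬ InClubComp G v x → x ∉ S
    kept-¬club⇒∉S x∉ ¬cx =
      [ (λ x∉S → x∉S) , (λ cx → ⊥-elim (¬cx cx)) ] (proj₂ (∉-exchange⁻ x∉))

    kept-¬club-Reach : ∀ {x y} → ¬ InClubComp G v x → Reach G Kept x y →
                       Reach G (_∉ S) x y × ¬ InClubComp G v y
    kept-¬club-Reach ¬cx (here x∉) = here (kept-¬club⇒∉S x∉ ¬cx) , ¬cx
    kept-¬club-Reach ¬cx (step x∉ xz r)
      with kept-¬club-Reach (¬club-Edge ¬cx (kept⇒≢v x∉) xz (kept⇒≢v (Reach-start r))) r
    ... | z↝y , ¬cy = step (kept-¬club⇒∉S x∉ ¬cx) xz z↝y , ¬cy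

    commonNbhd⊆exchange : ∀ {x y} → x ≢ v → ¬ InClubComp G v x → ¬ CommonOutside x y →
                          commonNbhd G x y ⊆ exchange S
    commonNbhd⊆exchange {x} x≢v ¬cx none {c} c∈ with ∈-commonNbhd⁻ c∈ | c ≟ v
    ... | _   , _   | yes c≡v = ∈-exchange⁺ (inj₁ c≡v)
    ... | x~c , y~c | no c≢v  = ∈-exchange⁺ (inj₂ (c∈S , ¬club-Edge ¬cx x≢v x~c c≢v))
      where
      c∈S : c ∈ S
      c∈S = decidable-stable (c ∈? S) (λ c∉S → none (c , c∉S , c≢v , x~c , Edge-sym y~c))

    -- Without a common neighbour outside S ∪ {v}, the middle vertex of a path x c y in
    -- G - S is v, and robust(x, y) > k contradicts w(N(x) ∩ N(y)) ≤ w(exchange S) ≤ w(S) ≤ k.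
    P4-CommonOutside : ∀ {x z m y} → x ≢ v → y ≢ v →
                       ¬ InClubComp G v x → ¬ InClubComp G v y →
                       Reach G (_∉ S) x y → InducedP4 G x z m y → CommonOutside x y
    P4-CommonOutside {x} {z} {m} {y} x≢v y≢v ¬cx ¬cy x↝y
                     p4@((_ , _ , x≢y , _) , _ , (_ , _ , ¬xy))
      with any? (λ c → ¬? (c ∈? S) ×-dec ¬? (c ≟ v) ×-dec Edge? x c ×-dec Edge? c y)
    ... | yes common = common
    ... | no none with S-cluster x y x↝y
    ...   | inj₁ x≡y       = ⊥-elim (x≢y x≡y)
    ...   | inj₂ (inj₁ xy) = ⊥-elim (¬xy xy)
    ...   | inj₂ (inj₂ (c , c∉S , xc , cy)) with c ≟ v
    ...     | no c≢v   = ⊥-elim (none (c , c∉S , c≢v , xc , cy))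
    ...     | yes refl with robust x y x≢y (Edge-sym xc) (x≢v , ¬cx) cy (y≢v , ¬cy)
    ...       | inj₁ no-P4 = ⊥-elim (no-P4 (z , m , p4))
    ...       | inj₂ k<wN  = ⊥-elim (≤⇒≯ (≤-trans (exchange-bounded u∈S cu
                               (commonNbhd⊆exchange x≢v ¬cx none)) wS≤k) k<wN)

    club-component : ∀ {x y} → InClubComp G v x → Reach G Kept x y → Dist≤2 G Kept x y
    club-component cx@(x≢v , diam) r =
      Dist≤2-mono (λ m≢v xm → ∉-exchange⁺ m≢v (inj₂ (club-Reach cx (step x≢v xm (here m≢v)))))
                  (diam _ _ (here x≢v) (Reach-mono kept⇒≢v r))

    nonclub-component : ∀ {x y} → ¬ InClubComp G v x → Reach G Kept x y → Dist≤2 G Kept x y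
    nonclub-component _ (here _) = inj₁ refl
    nonclub-component ¬cx (step x∉ xz r)
      with nonclub-component (¬club-Edge ¬cx (kept⇒≢v x∉) xz (kept⇒≢v (Reach-start r))) r
    ... | inj₁ refl      = inj₂ (inj₁ xz)
    ... | inj₂ (inj₁ zy) = inj₂ (inj₂ (_ , Reach-start r , xz , zy))
    ... | inj₂ (inj₂ (m , m∉ , zm , my)) with walk-shortcut-or-P4 (Reach-start r) m∉ xz zm my
    ...   | inj₁ short = short
    ...   | inj₂ p4
      with kept-¬club-Reach ¬cx
             (step x∉ xz (step (Reach-start r) zm (step m∉ my (here (Reach-end r)))))
    ...   | x↝y , ¬cy
      with P4-CommonOutside (kept⇒≢v x∉) (kept⇒≢v (Reach-end r)) ¬cx ¬cy x↝y p4
    ...   | c , c∉S , c≢v , xc , cy = inj₂ (inj₂ (c , ∉-exchange⁺ c≢v (inj₁ c∉S) , xc , cy))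

    exchange-cluster : Is2ClubCluster G Kept
    exchange-cluster x y r with InClubComp? x
    ... | yes cx  = club-component cx r
    ... | no ¬cx = nonclub-component ¬cx r

lemma6 : (G : Graph) (k : ℕ) (F : Vtx G → Set) (w : Vtx G → ℕ) →
    (∀ x → 0 < w x) →
    (v : Vtx G) → ¬ F v →
    (∀ a b → a ≢ b → Edge G v a → InH G v a → Edge G v b → InH G v b →
      RobustGt G w a b k) →
    (∀ u → InClubComp G v u → w v ≤ w u) →
    YesInstance G k F w ⇔ YesInstance G k (λ x → F x ⊎ InClubComp G v x) w
lemma6 G k F w _ v ¬Fv robust w-club = mk⇔ protect-clubs forget-clubs
  where
  open Clubs G v using (InClubComp?)
  open Exchange G w v w-club

  protect-clubs : YesInstance G k F w → YesInstance G k (λ x → F x ⊎ InClubComp G v x) w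
  protect-clubs (S , wS≤k , S∩F , S-cluster) with any? (λ x → x ∈? S ×-dec InClubComp? x)
  ... | yes (u , u∈S , cu) =
    exchange S , ≤-trans (exchange-bounded u∈S cu ⊆-refl) wS≤k ,
    exchange-avoids ¬Fv S∩F , exchange-cluster robust S-cluster wS≤k u∈S cu
  ... | no S∩clubs=∅ =
    S , wS≤k , (λ x x∈S → [ S∩F x x∈S , (λ cx → S∩clubs=∅ (x , x∈S , cx)) ]) , S-cluster

  forget-clubs : YesInstance G k (λ x → F x ⊎ InClubComp G v x) w → YesInstance G k F w
  forget-clubs (S , wS≤k , S∩F′ , S-cluster) =
    S , wS≤k , (λ x x∈S → S∩F′ x x∈S ∘ inj₁) , S-cluster
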